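{- Let $k\in\mathbb{R}$, $k>0$, and let $M=\begin{pmatrix} k-1 & k-1 & k\\ 1&0&0\\ 0&1&0\end{pmatrix}$ (which is invertible). For every integer $n\geq 1$, $$M^{ -n}=\left(M^{ -1}\right)^{n}=\left(M^{n}\right)^{ -1}=\begin{pmatrix} J_{ -(n-1)}^{(3)}(k) & T_{ -(n+1)}^{(3)}(k) & kJ_{ -n}^{(3)}(k) \\ J_{ -n}^{(3)}(k) & T_{ -(n+2)}^{(3)}(k) & kJ_{ -(n+1)}^{(3)}(k)\\ J_{ -(n+1)}^{(3)}(k) & T_{ -(n+3)}^{(3)}(k) & kJ_{ -(n+2)}^{(3)}(k) \end{pmatrix},$$ where $T_{ -m}^{(3)}(k)=(k-1)J_{ -(m-1)}^{(3)}(k)+kJ_{ -m}^{(3)}(k)$ for every integer $m$.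
   Context: For $k>0$, the third-order $k$-Jacobsthal sequence $(J_n^{(3)}(k))$ is defined by $J_0^{(3)}(k)=0$, $J_1^{(3)}(k)=1$, $J_2^{(3)}(k)=k-1$ and $J_{n+3}^{(3)}(k)=(k-1)J_{n+2}^{(3)}(k)+(k-1)J_{n+1}^{(3)}(k)+kJ_{n}^{(3)}(k)$. It is extended to negative indices by requiring the recurrence to hold for all integers $n$, i.e. $J_{ -n}^{(3)}(k)=\frac{1-k}{k}J_{ -(n-1)}^{(3)}(k)+\frac{1-k}{k}J_{ -(n-2)}^{(3)}(k)+\frac{1}{k}J_{ -(n-3)}^{(3)}(k)$ for $n\geq1$. -}

module Defs where

open import Level using (_⊔_)
open import Data.Nat using (ℕ; zero; suc; _∸_)
open import Data.Product using (_×_)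
open import Data.Fin using (Fin; zero; suc)
open import Algebra.Bundles using (CommutativeRing)

-- 3×3 matrices over a commutative ring R (with k a unit of R, kinv its inverse),
-- and the third-order k-Jacobsthal numbers at non-positive indices.
module Jacobsthal {c ℓ} (R : CommutativeRing c ℓ) (k kinv : CommutativeRing.Carrier R) where
  open CommutativeRing R hiding (zero)

  Mat : Set c
  Mat = Fin 3 → Fin 3 → Carrier

  _≈ᴹ_ : Mat → Mat → Set ℓ
  A ≈ᴹ B = ∀ i j → A i j ≈ B i j

  _⊗_ : Mat → Mat → Mat
  (A ⊗ B) i j = A i zero * B zero j + A i (suc zero) * B (suc zero) j
                + A i (suc (suc zero)) * B (suc (suc zero)) j

  Id : Mat
  Id zero zero = 1#
  Id (suc zero) (suc zero) = 1#
  Id (suc (suc zero)) (suc (suc zero)) = 1#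
  Id _ _ = 0#

  _^ᴹ_ : Mat → ℕ → Mat
  A ^ᴹ zero = Id
  A ^ᴹ suc n = A ⊗ (A ^ᴹ n)

  IsInverse : Mat → Mat → Set ℓ
  IsInverse A B = ((A ⊗ B) ≈ᴹ Id) × ((B ⊗ A) ≈ᴹ Id)

  M : Mat
  M zero zero = k - 1#
  M zero (suc zero) = k - 1#
  M zero (suc (suc zero)) = k
  M (suc zero) zero = 1#
  M (suc (suc zero)) (suc zero) = 1#
  M _ _ = 0#

  step : Carrier → Carrier → Carrier → Carrier
  step a b d = (1# - k) * kinv * a + (1# - k) * kinv * b + kinv * d

  -- Jneg n = J^{(3)}_{-n}(k); J_0 = 0, J_1 = 1, J_2 = k - 1
  Jneg : ℕ → Carrier
  Jneg zero = 0#
  Jneg (suc zero) = step 0# 1# (k - 1#)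
  Jneg (suc (suc zero)) = step (Jneg 1) 0# 1#
  Jneg (suc (suc (suc n))) = step (Jneg (suc (suc n))) (Jneg (suc n)) (Jneg n)

  -- Tneg (suc m) = T^{(3)}_{-(m+1)}(k) = (k-1) J_{-m} + k J_{-(m+1)}
  -- Tneg m = T^{(3)}_{-m}(k); only m ≥ 2 is used. For m = 0 we set
  -- T_0 = (k-1) J_1 + k J_0 = k - 1, matching the paper's formula.
  Tneg : ℕ → Carrier
  Tneg zero = (k - 1#) * 1# + k * Jneg 0
  Tneg (suc m) = (k - 1#) * Jneg m + k * Jneg (suc m)

  Aneg : ℕ → Mat
  Aneg n zero zero = Jneg (n ∸ 1)
  Aneg n zero (suc zero) = Tneg (suc n)
  Aneg n zero (suc (suc zero)) = k * Jneg n
  Aneg n (suc zero) zero = Jneg n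
  Aneg n (suc zero) (suc zero) = Tneg (suc (suc n))
  Aneg n (suc zero) (suc (suc zero)) = k * Jneg (suc n)
  Aneg n (suc (suc zero)) zero = Jneg (suc n)
  Aneg n (suc (suc zero)) (suc zero) = Tneg (suc (suc (suc n)))
  Aneg n (suc (suc zero)) (suc (suc zero)) = k * Jneg (suc (suc n))

-- The explicit matrix M⁻¹ with rows (0, 1, 0), (0, 0, 1), (kinv, (1-k) kinv, (1-k) kinv) is a
-- two-sided inverse of M, and it coincides with the claimed matrix at n = 1. Left multiplication
-- by M⁻¹ shifts rows 1 and 2 up and replaces row 2 by the backward Jacobsthal recurrence applied
-- to the three rows, which is exactly how the claimed matrices at n and n + 1 are related; hence
-- (M⁻¹)ⁿ is the claimed matrix. Since inverses in a monoid are unique and the inverse of Mⁿ is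
-- (M⁻¹)ⁿ, all three descriptions of M⁻ⁿ agree.
module Submission where

open import Defs
open import Data.Nat using (ℕ; _≤_; zero; suc; s≤s; z≤n)
open import Data.Product using (_×_; Σ; _,_)
open import Algebra.Bundles using (CommutativeRing; Monoid; RawRing)
open import Algebra.Solver.Ring.AlmostCommutativeRing using (fromCommutativeRing; _-Raw-AlmostCommutative⟶_)
open import Data.Fin using (zero; suc)
open import Data.Maybe using (Maybe; just; nothing)
import Data.Nat as ℕ
open import Data.Nat.Properties using (+-comm)
open import Data.Product.Properties using (≡-dec)
open import Level using (0ℓ)
open import Relation.Binary.PropositionalEquality as ≡ using (_≡_)
open import Relation.Nullary.Decidable using (yes; no)

module MonoidInverses {a ℓ} (M : Monoid a ℓ) where
  open Monoid M
  open import Algebra.Properties.Monoid M using (introʳ; cancelˡ; cancelᶜ)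
  open import Algebra.Properties.Monoid.Mult M using (×-homo-1; ×-homo-+; ×-congˡ) renaming (_×_ to _·_)

  inverse-unique : ∀ {x y z} → y ∙ x ≈ ε → x ∙ z ≈ ε → y ≈ z
  inverse-unique {x} {y} {z} yx≈ε xz≈ε = trans (introʳ xz≈ε y) (cancelˡ yx≈ε z)

  ·-inverse : ∀ {x y} → x ∙ y ≈ ε → ∀ n → (n · x) ∙ (n · y) ≈ ε
  ·-inverse xy≈ε zero = identityˡ ε
  ·-inverse {x} {y} xy≈ε (suc n) = begin
    (x ∙ n · x) ∙ (suc n · y)   ≈⟨ ∙-congˡ (sym (·-suc-last n)) ⟩
    (x ∙ n · x) ∙ (n · y ∙ y)   ≈⟨ cancelᶜ (·-inverse xy≈ε n) x y ⟩
    x ∙ y                       ≈⟨ xy≈ε ⟩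
    ε                           ∎
    where
    open import Relation.Binary.Reasoning.Setoid setoid
    ·-suc-last : ∀ n → n · y ∙ y ≈ suc n · y
    ·-suc-last n = trans (∙-congˡ (sym (×-homo-1 y))) (trans (sym (×-homo-+ y n 1)) (×-congˡ (+-comm n 1)))

ℕ² : Set
ℕ² = ℕ × ℕ

-- The solver checks that both sides have literally the same normal form, so constants must
-- cancel computationally: coefficients are pairs (a , b) standing for the integer a − b, and
-- ⟦_⟧ cancels common successors first, so that equal integers get the same image in R.
module IntegerCoefficients {c ℓ} (R : CommutativeRing c ℓ) where
  open CommutativeRing R
  open import Algebra.Properties.Semiring.Mult.TCOptimised semiring
    using (1+×; ×-homo-+; ×1-homo-*) renaming (_×_ to _·_)
  open import Algebra.Properties.Ring ring using (-0#≈0#; x[y-z]≈xy-xz; [y-z]x≈yx-zx)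
  open import Algebra.Properties.AbelianGroup +-abelianGroup using (⁻¹-anti-homo‿-; ⁻¹-∙-comm)
  open import Algebra.Properties.CommutativeSemigroup +-commutativeSemigroup using (interchange)
  open import Relation.Binary.Reasoning.Setoid setoid

  [x+y]-[u+v]≈[x-u]+[y-v] : ∀ x y u v → (x + y) - (u + v) ≈ (x - u) + (y - v)
  [x+y]-[u+v]≈[x-u]+[y-v] x y u v = begin
    (x + y) - (u + v)    ≈⟨ +-congˡ (⁻¹-∙-comm u v) ⟨
    (x + y) + (- u - v)  ≈⟨ interchange x y (- u) (- v) ⟩
    (x - u) + (y - v)    ∎

  [1+x]-[1+y]≈x-y : ∀ x y → (1# + x) - (1# + y) ≈ x - y
  [1+x]-[1+y]≈x-y x y = begin
    (1# + x) - (1# + y)  ≈⟨ [x+y]-[u+v]≈[x-u]+[y-v] 1# x 1# y ⟩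
    (1# - 1#) + (x - y)  ≈⟨ +-congʳ (-‿inverseʳ 1#) ⟩
    0# + (x - y)         ≈⟨ +-identityˡ (x - y) ⟩
    x - y                ∎

  [x-y][u-v]≈[xu+yv]-[xv+yu] : ∀ x y u v → (x - y) * (u - v) ≈ (x * u + y * v) - (x * v + y * u)
  [x-y][u-v]≈[xu+yv]-[xv+yu] x y u v = begin
    (x - y) * (u - v)                  ≈⟨ [y-z]x≈yx-zx (u - v) x y ⟩
    x * (u - v) - y * (u - v)          ≈⟨ +-cong (x[y-z]≈xy-xz x u v) (-‿cong (x[y-z]≈xy-xz y u v)) ⟩
    (x * u - x * v) - (y * u - y * v)  ≈⟨ +-congˡ (⁻¹-anti-homo‿- (y * u) (y * v)) ⟩
    (x * u - x * v) + (y * v - y * u)  ≈⟨ [x+y]-[u+v]≈[x-u]+[y-v] (x * u) (y * v) (x * v) (y * u) ⟨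
    (x * u + y * v) - (x * v + y * u)  ∎

  ℤ-rawRing : RawRing 0ℓ 0ℓ
  ℤ-rawRing = record
    { Carrier = ℕ²
    ; _≈_     = _≡_
    ; _+_     = λ { (a , b) (c , d) → (a ℕ.+ c , b ℕ.+ d) }
    ; _*_     = λ { (a , b) (c , d) → (a ℕ.* c ℕ.+ b ℕ.* d , a ℕ.* d ℕ.+ b ℕ.* c) }
    ; -_      = λ { (a , b) → (b , a) }
    ; 0#      = (0 , 0)
    ; 1#      = (1 , 0)
    }

  cancel : ℕ² → ℕ²
  cancel (suc a , suc b) = cancel (a , b)
  cancel p               = p

  ⟦_⟧ : ℕ² → Carrier
  ⟦ a , zero ⟧         = a · 1#
  ⟦ zero , suc b ⟧     = - (suc b · 1#)
  ⟦ suc a , suc b ⟧    = ⟦ a , b ⟧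

  ⟦cancel⟧ : ∀ p → ⟦ cancel p ⟧ ≈ ⟦ p ⟧
  ⟦cancel⟧ (zero , zero)    = refl
  ⟦cancel⟧ (zero , suc b)   = refl
  ⟦cancel⟧ (suc a , zero)   = refl
  ⟦cancel⟧ (suc a , suc b)  = ⟦cancel⟧ (a , b)

  ⟦⟧≈difference : ∀ a b → ⟦ a , b ⟧ ≈ a · 1# - b · 1#
  ⟦⟧≈difference a zero = sym (trans (+-congˡ -0#≈0#) (+-identityʳ (a · 1#)))
  ⟦⟧≈difference zero (suc b) = sym (+-identityˡ (- (suc b · 1#)))
  ⟦⟧≈difference (suc a) (suc b) = begin
    ⟦ a , b ⟧                      ≈⟨ ⟦⟧≈difference a b ⟩
    a · 1# - b · 1#                ≈⟨ [1+x]-[1+y]≈x-y (a · 1#) (b · 1#) ⟨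
    (1# + a · 1#) - (1# + b · 1#)  ≈⟨ +-cong (1+× a 1#) (-‿cong (1+× b 1#)) ⟨
    suc a · 1# - suc b · 1#        ∎

  ⟦⟧-homo-+ : ∀ a b c d → ⟦ a ℕ.+ c , b ℕ.+ d ⟧ ≈ ⟦ a , b ⟧ + ⟦ c , d ⟧
  ⟦⟧-homo-+ a b c d = begin
    ⟦ a ℕ.+ c , b ℕ.+ d ⟧                  ≈⟨ ⟦⟧≈difference (a ℕ.+ c) (b ℕ.+ d) ⟩
    (a ℕ.+ c) · 1# - (b ℕ.+ d) · 1#        ≈⟨ +-cong (×-homo-+ 1# a c) (-‿cong (×-homo-+ 1# b d)) ⟩
    (a · 1# + c · 1#) - (b · 1# + d · 1#)  ≈⟨ [x+y]-[u+v]≈[x-u]+[y-v] (a · 1#) (c · 1#) (b · 1#) (d · 1#) ⟩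
    (a · 1# - b · 1#) + (c · 1# - d · 1#)  ≈⟨ +-cong (⟦⟧≈difference a b) (⟦⟧≈difference c d) ⟨
    ⟦ a , b ⟧ + ⟦ c , d ⟧                  ∎

  ⟦⟧-homo-* : ∀ a b c d → ⟦ a ℕ.* c ℕ.+ b ℕ.* d , a ℕ.* d ℕ.+ b ℕ.* c ⟧ ≈ ⟦ a , b ⟧ * ⟦ c , d ⟧
  ⟦⟧-homo-* a b c d = begin
    ⟦ a ℕ.* c ℕ.+ b ℕ.* d , a ℕ.* d ℕ.+ b ℕ.* c ⟧
      ≈⟨ ⟦⟧≈difference (a ℕ.* c ℕ.+ b ℕ.* d) (a ℕ.* d ℕ.+ b ℕ.* c) ⟩
    (a ℕ.* c ℕ.+ b ℕ.* d) · 1# - (a ℕ.* d ℕ.+ b ℕ.* c) · 1#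
      ≈⟨ +-cong (·1-homo-*+* a c b d) (-‿cong (·1-homo-*+* a d b c)) ⟩
    (a · 1# * (c · 1#) + b · 1# * (d · 1#)) - (a · 1# * (d · 1#) + b · 1# * (c · 1#))
      ≈⟨ [x-y][u-v]≈[xu+yv]-[xv+yu] (a · 1#) (b · 1#) (c · 1#) (d · 1#) ⟨
    (a · 1# - b · 1#) * (c · 1# - d · 1#)
      ≈⟨ *-cong (⟦⟧≈difference a b) (⟦⟧≈difference c d) ⟨
    ⟦ a , b ⟧ * ⟦ c , d ⟧ ∎
    where
    ·1-homo-*+* : ∀ a c b d → (a ℕ.* c ℕ.+ b ℕ.* d) · 1# ≈ a · 1# * (c · 1#) + b · 1# * (d · 1#)
    ·1-homo-*+* a c b d = trans (×-homo-+ 1# (a ℕ.* c) (b ℕ.* d)) (+-cong (×1-homo-* a c) (×1-homo-* b d))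

  ⟦⟧-homo-neg : ∀ a b → ⟦ b , a ⟧ ≈ - ⟦ a , b ⟧
  ⟦⟧-homo-neg a b = begin
    ⟦ b , a ⟧            ≈⟨ ⟦⟧≈difference b a ⟩
    b · 1# - a · 1#      ≈⟨ ⁻¹-anti-homo‿- (a · 1#) (b · 1#) ⟨
    - (a · 1# - b · 1#)  ≈⟨ -‿cong (⟦⟧≈difference a b) ⟨
    - ⟦ a , b ⟧          ∎

  ℤ-morphism : ℤ-rawRing -Raw-AlmostCommutative⟶ fromCommutativeRing R
  ℤ-morphism = record
    { ⟦_⟧    = ⟦_⟧
    ; +-homo = λ { (a , b) (c , d) → ⟦⟧-homo-+ a b c d }
    ; *-homo = λ { (a , b) (c , d) → ⟦⟧-homo-* a b c d }
    ; -‿homo = λ { (a , b) → ⟦⟧-homo-neg a b }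
    ; 0-homo = refl
    ; 1-homo = refl
    }

  _≟⟦⟧_ : ∀ p q → Maybe (⟦ p ⟧ ≈ ⟦ q ⟧)
  p ≟⟦⟧ q with ≡-dec ℕ._≟_ ℕ._≟_ (cancel p) (cancel q)
  ... | yes cancel-p≡cancel-q =
          just (trans (sym (⟦cancel⟧ p)) (trans (reflexive (≡.cong ⟦_⟧ cancel-p≡cancel-q)) (⟦cancel⟧ q)))
  ... | no _ = nothing

  open import Algebra.Solver.Ring ℤ-rawRing (fromCommutativeRing R) ℤ-morphism _≟⟦⟧_ public
    using (Polynomial; solve; _:=_; _:+_; _:*_; _:-_; con)

  1ᴾ 0ᴾ : ∀ {m} → Polynomial m
  1ᴾ = con (1 , 0)
  0ᴾ = con (0 , 0)

-- The matrix operations of Jacobsthal do not involve k and kinv.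
module MatrixMonoid {c ℓ} (R : CommutativeRing c ℓ) (k kinv : CommutativeRing.Carrier R) where
  open CommutativeRing R hiding (zero)
  open Jacobsthal R k kinv
  open IntegerCoefficients R
  open import Algebra.Definitions _≈ᴹ_ using (Congruent₂; Associative; LeftIdentity; RightIdentity)

  1a+0b+0d≈a : ∀ a b d → 1# * a + 0# * b + 0# * d ≈ a
  1a+0b+0d≈a = solve 3 (λ a b d → 1ᴾ :* a :+ 0ᴾ :* b :+ 0ᴾ :* d := a) refl

  0a+1b+0d≈b : ∀ a b d → 0# * a + 1# * b + 0# * d ≈ b
  0a+1b+0d≈b = solve 3 (λ a b d → 0ᴾ :* a :+ 1ᴾ :* b :+ 0ᴾ :* d := b) refl

  0a+0b+1d≈d : ∀ a b d → 0# * a + 0# * b + 1# * d ≈ d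
  0a+0b+1d≈d = solve 3 (λ a b d → 0ᴾ :* a :+ 0ᴾ :* b :+ 1ᴾ :* d := d) refl

  a1+b0+d0≈a : ∀ a b d → a * 1# + b * 0# + d * 0# ≈ a
  a1+b0+d0≈a = solve 3 (λ a b d → a :* 1ᴾ :+ b :* 0ᴾ :+ d :* 0ᴾ := a) refl

  a0+b1+d0≈b : ∀ a b d → a * 0# + b * 1# + d * 0# ≈ b
  a0+b1+d0≈b = solve 3 (λ a b d → a :* 0ᴾ :+ b :* 1ᴾ :+ d :* 0ᴾ := b) refl

  a0+b0+d1≈d : ∀ a b d → a * 0# + b * 0# + d * 1# ≈ d
  a0+b0+d1≈d = solve 3 (λ a b d → a :* 0ᴾ :+ b :* 0ᴾ :+ d :* 1ᴾ := d) refl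

  ⊗-cong : Congruent₂ _⊗_
  ⊗-cong A≈A′ B≈B′ i j =
    +-cong (+-cong (*-cong (A≈A′ i zero) (B≈B′ zero j)) (*-cong (A≈A′ i (suc zero)) (B≈B′ (suc zero) j)))
           (*-cong (A≈A′ i (suc (suc zero))) (B≈B′ (suc (suc zero)) j))

  ⊗-assoc : Associative _⊗_
  ⊗-assoc A B C i j = solve 15
    (λ a₀ a₁ a₂ b₀₀ b₀₁ b₀₂ b₁₀ b₁₁ b₁₂ b₂₀ b₂₁ b₂₂ c₀ c₁ c₂ →
        (a₀ :* b₀₀ :+ a₁ :* b₁₀ :+ a₂ :* b₂₀) :* c₀
      :+ (a₀ :* b₀₁ :+ a₁ :* b₁₁ :+ a₂ :* b₂₁) :* c₁
      :+ (a₀ :* b₀₂ :+ a₁ :* b₁₂ :+ a₂ :* b₂₂) :* c₂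
      :=  a₀ :* (b₀₀ :* c₀ :+ b₀₁ :* c₁ :+ b₀₂ :* c₂)
      :+ a₁ :* (b₁₀ :* c₀ :+ b₁₁ :* c₁ :+ b₁₂ :* c₂)
      :+ a₂ :* (b₂₀ :* c₀ :+ b₂₁ :* c₁ :+ b₂₂ :* c₂))
    refl _ _ _ _ _ _ _ _ _ _ _ _ _ _ _

  ⊗-identityˡ : LeftIdentity Id _⊗_
  ⊗-identityˡ A zero j             = 1a+0b+0d≈a _ _ _
  ⊗-identityˡ A (suc zero) j       = 0a+1b+0d≈b _ _ _
  ⊗-identityˡ A (suc (suc zero)) j = 0a+0b+1d≈d _ _ _

  ⊗-identityʳ : RightIdentity Id _⊗_
  ⊗-identityʳ A i zero             = a1+b0+d0≈a _ _ _
  ⊗-identityʳ A i (suc zero)       = a0+b1+d0≈b _ _ _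
  ⊗-identityʳ A i (suc (suc zero)) = a0+b0+d1≈d _ _ _

  ⊗-monoid : Monoid c ℓ
  ⊗-monoid = record
    { Carrier  = Mat
    ; _≈_      = _≈ᴹ_
    ; _∙_      = _⊗_
    ; ε        = Id
    ; isMonoid = record
      { isSemigroup = record
        { isMagma = record
          { isEquivalence = record
            { refl  = λ i j → refl
            ; sym   = λ A≈B i j → sym (A≈B i j)
            ; trans = λ A≈B B≈C i j → trans (A≈B i j) (B≈C i j)
            }
          ; ∙-cong = ⊗-cong
          }
        ; assoc = ⊗-assoc
        }
      ; identity = ⊗-identityˡ , ⊗-identityʳ
      }
    }

  open Monoid ⊗-monoid public using () renaming (refl to ≈ᴹ-refl; sym to ≈ᴹ-sym; trans to ≈ᴹ-trans)
  open import Algebra.Properties.Monoid.Mult ⊗-monoid using (×-congʳ) renaming (_×_ to _·_)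
  open MonoidInverses ⊗-monoid using (inverse-unique; ·-inverse)

  ^ᴹ≡· : ∀ A n → A ^ᴹ n ≡ n · A
  ^ᴹ≡· A zero    = ≡.refl
  ^ᴹ≡· A (suc n) = ≡.cong (A ⊗_) (^ᴹ≡· A n)

  ^ᴹ-cong : ∀ {A B} → A ≈ᴹ B → ∀ n → (A ^ᴹ n) ≈ᴹ (B ^ᴹ n)
  ^ᴹ-cong {A} {B} A≈B n rewrite ^ᴹ≡· A n | ^ᴹ≡· B n = ×-congʳ n A≈B

  ^ᴹ-inverse : ∀ {A B} → (A ⊗ B) ≈ᴹ Id → ∀ n → ((A ^ᴹ n) ⊗ (B ^ᴹ n)) ≈ᴹ Id
  ^ᴹ-inverse {A} {B} AB≈Id n rewrite ^ᴹ≡· A n | ^ᴹ≡· B n = ·-inverse AB≈Id n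

  ^ᴹ-isInverse : ∀ {A B} → IsInverse A B → ∀ n → IsInverse (A ^ᴹ n) (B ^ᴹ n)
  ^ᴹ-isInverse {A} {B} (AB≈Id , BA≈Id) n = ^ᴹ-inverse {A} {B} AB≈Id n , ^ᴹ-inverse {B} {A} BA≈Id n

  IsInverse-unique : ∀ {A B C} → IsInverse A B → IsInverse A C → B ≈ᴹ C
  IsInverse-unique {A} {B} {C} (_ , BA≈Id) (AC≈Id , _) = inverse-unique {A} {B} {C} BA≈Id AC≈Id

  IsInverse-respʳ : ∀ {A B C} → B ≈ᴹ C → IsInverse A B → IsInverse A C
  IsInverse-respʳ {A} B≈C (AB≈Id , BA≈Id) =
    ≈ᴹ-trans (⊗-cong (≈ᴹ-refl {A}) (≈ᴹ-sym B≈C)) AB≈Id ,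
    ≈ᴹ-trans (⊗-cong (≈ᴹ-sym B≈C) (≈ᴹ-refl {A})) BA≈Id

module JacobsthalInverse {c ℓ} (R : CommutativeRing c ℓ) (k kinv : CommutativeRing.Carrier R) where
  open CommutativeRing R hiding (zero)
  open Jacobsthal R k kinv
  open IntegerCoefficients R
  open MatrixMonoid R k kinv

  M⁻¹ : Mat
  M⁻¹ zero (suc zero)                   = 1#
  M⁻¹ (suc zero) (suc (suc zero))       = 1#
  M⁻¹ (suc (suc zero)) zero             = kinv
  M⁻¹ (suc (suc zero)) (suc zero)       = (1# - k) * kinv
  M⁻¹ (suc (suc zero)) (suc (suc zero)) = (1# - k) * kinv
  M⁻¹ _ _                               = 0#

  -- Syntactic copies of the definitions, with κ and κ⁻¹ standing for k and kinv: for concrete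
  -- indices ⟦ Jnegᴾ n ⟧ unfolds to Jneg n, so the solver can work with them.
  module Syntax {m} (κ κ⁻¹ : Polynomial m) where
    unitᴾ : Polynomial m
    unitᴾ = κ :* κ⁻¹ :- 1ᴾ

    stepᴾ : Polynomial m → Polynomial m → Polynomial m → Polynomial m
    stepᴾ a b d = (1ᴾ :- κ) :* κ⁻¹ :* a :+ (1ᴾ :- κ) :* κ⁻¹ :* b :+ κ⁻¹ :* d

    Jnegᴾ : ℕ → Polynomial m
    Jnegᴾ zero                = 0ᴾ
    Jnegᴾ (suc zero)          = stepᴾ 0ᴾ 1ᴾ (κ :- 1ᴾ)
    Jnegᴾ (suc (suc zero))    = stepᴾ (Jnegᴾ 1) 0ᴾ 1ᴾ
    Jnegᴾ (suc (suc (suc n))) = stepᴾ (Jnegᴾ (suc (suc n))) (Jnegᴾ (suc n)) (Jnegᴾ n)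

    Tnegᴾ : ℕ → Polynomial m
    Tnegᴾ zero    = (κ :- 1ᴾ) :* 1ᴾ :+ κ :* Jnegᴾ 0
    Tnegᴾ (suc n) = (κ :- 1ᴾ) :* Jnegᴾ n :+ κ :* Jnegᴾ (suc n)

  M⁻¹⊗Aneg[1+n]≈Aneg[2+n] : ∀ n → (M⁻¹ ⊗ Aneg (suc n)) ≈ᴹ Aneg (suc (suc n))
  M⁻¹⊗Aneg[1+n]≈Aneg[2+n] n zero zero                         = 0a+1b+0d≈b _ _ _
  M⁻¹⊗Aneg[1+n]≈Aneg[2+n] n zero (suc zero)                   = 0a+1b+0d≈b _ _ _
  M⁻¹⊗Aneg[1+n]≈Aneg[2+n] n zero (suc (suc zero))             = 0a+1b+0d≈b _ _ _
  M⁻¹⊗Aneg[1+n]≈Aneg[2+n] n (suc zero) zero                   = 0a+0b+1d≈d _ _ _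
  M⁻¹⊗Aneg[1+n]≈Aneg[2+n] n (suc zero) (suc zero)             = 0a+0b+1d≈d _ _ _
  M⁻¹⊗Aneg[1+n]≈Aneg[2+n] n (suc zero) (suc (suc zero))       = 0a+0b+1d≈d _ _ _
  M⁻¹⊗Aneg[1+n]≈Aneg[2+n] n (suc (suc zero)) zero = solve 5
    (λ κ κ⁻¹ a b d → let open Syntax κ κ⁻¹ in
      κ⁻¹ :* a :+ (1ᴾ :- κ) :* κ⁻¹ :* b :+ (1ᴾ :- κ) :* κ⁻¹ :* d := stepᴾ d b a)
    refl k kinv (Jneg n) (Jneg (suc n)) (Jneg (suc (suc n)))
  M⁻¹⊗Aneg[1+n]≈Aneg[2+n] n (suc (suc zero)) (suc zero) = solve 5
    (λ κ κ⁻¹ a b d → let open Syntax κ κ⁻¹ in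
         κ⁻¹ :* ((κ :- 1ᴾ) :* a :+ κ :* b)
      :+ (1ᴾ :- κ) :* κ⁻¹ :* ((κ :- 1ᴾ) :* b :+ κ :* d)
      :+ (1ᴾ :- κ) :* κ⁻¹ :* ((κ :- 1ᴾ) :* d :+ κ :* stepᴾ d b a)
      := (κ :- 1ᴾ) :* stepᴾ d b a :+ κ :* stepᴾ (stepᴾ d b a) d b)
    refl k kinv (Jneg (suc n)) (Jneg (suc (suc n))) (Jneg (suc (suc (suc n))))
  M⁻¹⊗Aneg[1+n]≈Aneg[2+n] n (suc (suc zero)) (suc (suc zero)) = solve 5
    (λ κ κ⁻¹ a b d → let open Syntax κ κ⁻¹ in
      κ⁻¹ :* (κ :* a) :+ (1ᴾ :- κ) :* κ⁻¹ :* (κ :* b) :+ (1ᴾ :- κ) :* κ⁻¹ :* (κ :* d) := κ :* stepᴾ d b a)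
    refl k kinv (Jneg (suc n)) (Jneg (suc (suc n))) (Jneg (suc (suc (suc n))))

  module WithUnit (k*kinv≈1 : k * kinv ≈ 1#) where

    -- Identities that hold only because k * kinv ≈ 1# are proved by the solver in the form
    -- P = Q + (k kinv − 1) S, an identity of polynomials in the independent variables k, kinv.
    ≈-modulo-unit : ∀ {P Q S} → P ≈ Q + (k * kinv - 1#) * S → P ≈ Q
    ≈-modulo-unit {P} {Q} {S} P≈Q+unit*S = begin
      P                         ≈⟨ P≈Q+unit*S ⟩
      Q + (k * kinv - 1#) * S   ≈⟨ +-congˡ (*-congʳ (+-congʳ k*kinv≈1)) ⟩
      Q + (1# - 1#) * S         ≈⟨ +-congˡ (*-congʳ (-‿inverseʳ 1#)) ⟩
      Q + 0# * S                ≈⟨ +-congˡ (zeroˡ S) ⟩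
      Q + 0#                    ≈⟨ +-identityʳ Q ⟩
      Q                         ∎
      where open import Relation.Binary.Reasoning.Setoid setoid

    M⊗M⁻¹≈Id : (M ⊗ M⁻¹) ≈ᴹ Id
    M⊗M⁻¹≈Id zero zero = ≈-modulo-unit (solve 2
      (λ κ κ⁻¹ → let open Syntax κ κ⁻¹ in
        (κ :- 1ᴾ) :* 0ᴾ :+ (κ :- 1ᴾ) :* 0ᴾ :+ κ :* κ⁻¹ := 1ᴾ :+ unitᴾ :* 1ᴾ) refl k kinv)
    M⊗M⁻¹≈Id zero (suc zero) = ≈-modulo-unit (solve 2
      (λ κ κ⁻¹ → let open Syntax κ κ⁻¹ in
        (κ :- 1ᴾ) :* 1ᴾ :+ (κ :- 1ᴾ) :* 0ᴾ :+ κ :* ((1ᴾ :- κ) :* κ⁻¹) := 0ᴾ :+ unitᴾ :* (1ᴾ :- κ)) refl k kinv)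
    M⊗M⁻¹≈Id zero (suc (suc zero)) = ≈-modulo-unit (solve 2
      (λ κ κ⁻¹ → let open Syntax κ κ⁻¹ in
        (κ :- 1ᴾ) :* 0ᴾ :+ (κ :- 1ᴾ) :* 1ᴾ :+ κ :* ((1ᴾ :- κ) :* κ⁻¹) := 0ᴾ :+ unitᴾ :* (1ᴾ :- κ)) refl k kinv)
    M⊗M⁻¹≈Id (suc zero) zero                   = 1a+0b+0d≈a _ _ _
    M⊗M⁻¹≈Id (suc zero) (suc zero)             = 1a+0b+0d≈a _ _ _
    M⊗M⁻¹≈Id (suc zero) (suc (suc zero))       = 1a+0b+0d≈a _ _ _
    M⊗M⁻¹≈Id (suc (suc zero)) zero             = 0a+1b+0d≈b _ _ _
    M⊗M⁻¹≈Id (suc (suc zero)) (suc zero)       = 0a+1b+0d≈b _ _ _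
    M⊗M⁻¹≈Id (suc (suc zero)) (suc (suc zero)) = 0a+1b+0d≈b _ _ _

    M⁻¹⊗M≈Id : (M⁻¹ ⊗ M) ≈ᴹ Id
    M⁻¹⊗M≈Id zero zero                   = 0a+1b+0d≈b _ _ _
    M⁻¹⊗M≈Id zero (suc zero)             = 0a+1b+0d≈b _ _ _
    M⁻¹⊗M≈Id zero (suc (suc zero))       = 0a+1b+0d≈b _ _ _
    M⁻¹⊗M≈Id (suc zero) zero             = 0a+0b+1d≈d _ _ _
    M⁻¹⊗M≈Id (suc zero) (suc zero)       = 0a+0b+1d≈d _ _ _
    M⁻¹⊗M≈Id (suc zero) (suc (suc zero)) = 0a+0b+1d≈d _ _ _
    M⁻¹⊗M≈Id (suc (suc zero)) zero = solve 2
      (λ κ κ⁻¹ → κ⁻¹ :* (κ :- 1ᴾ) :+ (1ᴾ :- κ) :* κ⁻¹ :* 1ᴾ :+ (1ᴾ :- κ) :* κ⁻¹ :* 0ᴾ := 0ᴾ) refl k kinv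
    M⁻¹⊗M≈Id (suc (suc zero)) (suc zero) = solve 2
      (λ κ κ⁻¹ → κ⁻¹ :* (κ :- 1ᴾ) :+ (1ᴾ :- κ) :* κ⁻¹ :* 0ᴾ :+ (1ᴾ :- κ) :* κ⁻¹ :* 1ᴾ := 0ᴾ) refl k kinv
    M⁻¹⊗M≈Id (suc (suc zero)) (suc (suc zero)) = ≈-modulo-unit (solve 2
      (λ κ κ⁻¹ → let open Syntax κ κ⁻¹ in
        κ⁻¹ :* κ :+ (1ᴾ :- κ) :* κ⁻¹ :* 0ᴾ :+ (1ᴾ :- κ) :* κ⁻¹ :* 0ᴾ := 1ᴾ :+ unitᴾ :* 1ᴾ) refl k kinv)

    M-isInverse : IsInverse M M⁻¹
    M-isInverse = M⊗M⁻¹≈Id , M⁻¹⊗M≈Id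

    Aneg1≈M⁻¹ : Aneg 1 ≈ᴹ M⁻¹
    Aneg1≈M⁻¹ zero zero = refl
    Aneg1≈M⁻¹ zero (suc zero) = ≈-modulo-unit (solve 2
      (λ κ κ⁻¹ → let open Syntax κ κ⁻¹ in Tnegᴾ 2 := 1ᴾ :+ unitᴾ :* 1ᴾ) refl k kinv)
    Aneg1≈M⁻¹ zero (suc (suc zero)) = solve 2
      (λ κ κ⁻¹ → let open Syntax κ κ⁻¹ in κ :* Jnegᴾ 1 := 0ᴾ) refl k kinv
    Aneg1≈M⁻¹ (suc zero) zero = solve 2
      (λ κ κ⁻¹ → let open Syntax κ κ⁻¹ in Jnegᴾ 1 := 0ᴾ) refl k kinv
    Aneg1≈M⁻¹ (suc zero) (suc zero) = ≈-modulo-unit (solve 2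
      (λ κ κ⁻¹ → let open Syntax κ κ⁻¹ in Tnegᴾ 3 := 0ᴾ :+ unitᴾ :* ((1ᴾ :- κ) :* κ⁻¹)) refl k kinv)
    Aneg1≈M⁻¹ (suc zero) (suc (suc zero)) = ≈-modulo-unit (solve 2
      (λ κ κ⁻¹ → let open Syntax κ κ⁻¹ in κ :* Jnegᴾ 2 := 1ᴾ :+ unitᴾ :* 1ᴾ) refl k kinv)
    Aneg1≈M⁻¹ (suc (suc zero)) zero = solve 2
      (λ κ κ⁻¹ → let open Syntax κ κ⁻¹ in Jnegᴾ 2 := κ⁻¹) refl k kinv
    Aneg1≈M⁻¹ (suc (suc zero)) (suc zero) = ≈-modulo-unit (solve 2
      (λ κ κ⁻¹ → let open Syntax κ κ⁻¹ in
        Tnegᴾ 4 := (1ᴾ :- κ) :* κ⁻¹ :+ unitᴾ :* ((1ᴾ :- κ) :* κ⁻¹ :* ((1ᴾ :- κ) :* κ⁻¹) :+ (1ᴾ :- κ) :* κ⁻¹))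
      refl k kinv)
    Aneg1≈M⁻¹ (suc (suc zero)) (suc (suc zero)) = ≈-modulo-unit (solve 2
      (λ κ κ⁻¹ → let open Syntax κ κ⁻¹ in
        κ :* Jnegᴾ 3 := (1ᴾ :- κ) :* κ⁻¹ :+ unitᴾ :* ((1ᴾ :- κ) :* κ⁻¹)) refl k kinv)

    M⁻¹^ᴹ≈Aneg : ∀ n → 1 ≤ n → (M⁻¹ ^ᴹ n) ≈ᴹ Aneg n
    M⁻¹^ᴹ≈Aneg (suc zero) _ = ≈ᴹ-trans (⊗-identityʳ M⁻¹) (≈ᴹ-sym Aneg1≈M⁻¹)
    M⁻¹^ᴹ≈Aneg (suc (suc n)) _ =
      ≈ᴹ-trans (⊗-cong (≈ᴹ-refl {M⁻¹}) (M⁻¹^ᴹ≈Aneg (suc n) (s≤s z≤n))) (M⁻¹⊗Aneg[1+n]≈Aneg[2+n] n)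

theorem3p1 : ∀ {c ℓ} (R : CommutativeRing c ℓ) (k kinv : CommutativeRing.Carrier R) →
    let open CommutativeRing R in
    k * kinv ≈ 1# →
    let open Jacobsthal R k kinv in
    (Σ Mat (λ X → IsInverse M X))
    × (∀ (X : Mat) → IsInverse M X → ∀ (n : ℕ) → 1 ≤ n → (X ^ᴹ n) ≈ᴹ Aneg n)
    × (∀ (n : ℕ) → 1 ≤ n → IsInverse (M ^ᴹ n) (Aneg n))
theorem3p1 R k kinv k*kinv≈1 =
    (M⁻¹ , M-isInverse)
  , (λ X X-isInverse n 1≤n →
       ≈ᴹ-trans (^ᴹ-cong (IsInverse-unique {M} {X} X-isInverse M-isInverse) n) (M⁻¹^ᴹ≈Aneg n 1≤n))
  , (λ n 1≤n → IsInverse-respʳ {M ^ᴹ n} (M⁻¹^ᴹ≈Aneg n 1≤n) (^ᴹ-isInverse {M} M-isInverse n))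
  where
  open Jacobsthal R k kinv using (M; _^ᴹ_)
  open MatrixMonoid R k kinv
  open JacobsthalInverse R k kinv
  open WithUnit k*kinv≈1
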